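{- Let $r$ be a fixed integer and let $\psi:2^{[n]}\to\mathbb N$ be an integral polymatroid rank function with $\psi(A)\le r$ for all $A\subseteq[n]$. Then the number of vertices of the polymatroid $\mathcal P(\psi)$ is bounded by a polynomial in $n$ of degree $r$.
   Context: A function $\psi:2^{[n]}\to\mathbb R$ is a polymatroid rank function if it is submodular ($\psi(X\cap Y)+\psi(X\cup Y)\le\psi(X)+\psi(Y)$), non-decreasing ($X\subseteq Y\Rightarrow\psi(X)\le\psi(Y)$), and $\psi(\emptyset)=0$. The polymatroid is $\mathcal P(\psi)=\{x\in\mathbb R^n:\sum_{i\in A}x_i\le\psi(A)\ \forall A\subseteq[n],\ x\ge0\}$. -}

module Defs where

open import Data.Nat as ℕ using (ℕ; zero; suc; _+_)
open import Data.Rational as ℚ using (ℚ; 0ℚ; ½)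
open import Data.Bool using (Bool; true; false; if_then_else_)
open import Data.Vec using (Vec; []; _∷_; lookup)
open import Data.Fin using (Fin)
open import Data.Fin.Subset using (Subset; _∩_; _∪_; _⊆_)
import Data.Fin.Subset as S
open import Data.Product using (_×_)
import Data.Integer
open import Relation.Binary.PropositionalEquality using (_≡_)

record IsPolymatroidRank {n : ℕ} (ψ : Subset n → ℕ) : Set where
  field
    submodular : ∀ X Y → ψ (X ∩ Y) + ψ (X ∪ Y) ℕ.≤ ψ X + ψ Y
    monotone   : ∀ X Y → X ⊆ Y → ψ X ℕ.≤ ψ Y
    empty      : ψ S.⊥ ≡ 0

sumOver : ∀ {n} → Subset n → Vec ℚ n → ℚ
sumOver []          []       = 0ℚ
sumOver (true ∷ A)  (q ∷ x)  = q ℚ.+ sumOver A x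
sumOver (false ∷ A) (q ∷ x)  = sumOver A x

InPolymatroid : ∀ {n} → (Subset n → ℕ) → Vec ℚ n → Set
InPolymatroid {n} ψ x =
  (∀ (i : Fin n) → 0ℚ ℚ.≤ lookup x i) ×
  (∀ (A : Subset n) → sumOver A x ℚ.≤ (Data.Integer.+ (ψ A)) ℚ./ 1)

IsVertex : ∀ {n} → (Subset n → ℕ) → Vec ℚ n → Set
IsVertex {n} ψ x =
  InPolymatroid ψ x ×
  (∀ y z → InPolymatroid ψ y → InPolymatroid ψ z →
     (∀ (i : Fin n) → lookup x i ≡ ½ ℚ.* (lookup y i ℚ.+ lookup z i)) → y ≡ z)

{-# OPTIONS --safe #-}

-- Every vertex x of an integral polymatroid is integral. Sets A with Σ_{i∈A} x_i = ψ(A) are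
-- called tight; by submodularity they are closed under intersection. Take a tight set T of
-- minimal size containing a fractional coordinate i. If T has another fractional coordinate j,
-- no tight set separates i from j (its intersection with T would be a smaller such set), so
-- x ± ε(e_i − e_j) stays in P(ψ) for small ε > 0, contradicting extremality; otherwise
-- x_i = ψ(T) − Σ_{k∈T, k≠i} x_k is an integer. A fractional coordinate outside every tight set
-- is moved along e_i instead. Hence vertices are points of ℕⁿ with coordinate sum at most
-- ψ([n]) ≤ r, and there are at most (n+1)^r of those.

module Submission where

open import Defs
open import Data.Bool using (true; false)
open import Data.Empty using (⊥; ⊥-elim)
open import Data.Fin using (Fin; zero; suc)
open import Data.Fin.Properties using (suc-injective; any?) renaming (_≟_ to _≟ᶠ_)
open import Data.Fin.Subset using (Subset; _∩_; _∪_; _∈_; _∉_; ⊤) renaming (∣_∣ to ∣_∣ˢ)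
open import Data.Fin.Subset.Properties using (_∈?_; p⊂q⇒∣p∣<∣q∣; p∩q⊆q; x∈p∩q⁻; x∈p∩q⁺)
open import Data.Integer as ℤ using (ℤ; +_; -[1+_]; +≤+)
open import Data.Integer.Properties as ℤ using (drop‿+≤+)
open import Data.List as List using (List; []; _∷_; _++_; length; allFin)
open import Data.List.Membership.Propositional using () renaming (_∈_ to _∈ₗ_)
open import Data.List.Membership.Propositional.Properties using (∈-map⁺; ∈-++⁺ˡ; ∈-++⁺ʳ; ∈-allFin)
open import Data.List.Properties using (length-map; length-++)
open import Data.List.Relation.Unary.All as All using (All)
open import Data.List.Relation.Unary.Any using (here; there)
open import Data.List.Relation.Unary.AllPairs using (_∷_)
open import Data.List.Relation.Unary.Unique.Propositional using (Unique)
open import Data.Nat as ℕ using (ℕ; zero; suc; _^_; z≤n; s≤s)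
import Data.Nat.Coprimality as Coprime
open import Data.Nat.Induction using (<-wellFounded)
import Data.Nat.Properties as ℕ
open import Data.Product using (∃-syntax; _×_; _,_; proj₁; proj₂)
open import Data.Rational as ℚ
  using (ℚ; mkℚ; 0ℚ; 1ℚ; ½; _+_; _*_; -_; _-_; _≤_; _<_; _/_; _⊓_; ∣_∣; 1/_; *≤*; NonZero; positive; nonNegative)
open import Data.Rational.Properties
open import Algebra.Properties.Group +-0-group using () renaming (⁻¹-involutive to neg-involutive)
open import Data.Rational.Solver using (module +-*-Solver)
open import Data.Sum using (_⊎_; inj₁; inj₂)
open import Data.Vec as Vec using (Vec; []; _∷_; lookup; zipWith; map; replicate)
open import Data.Vec.Properties using (lookup-map; lookup-zipWith; lookup-replicate)
open import Function using (_∘_)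
open import Induction.WellFounded using (Acc; acc)
open import Relation.Binary.Definitions using (tri<; tri≈; tri>)
open import Relation.Binary.PropositionalEquality
open import Relation.Nullary using (¬_; yes; no)
open import Relation.Nullary.Decidable using (¬?; _×-dec_; decidable-stable)
open import Relation.Unary using (Decidable)

open +-*-Solver

-- Chosen so that `fromℕ (ψ A)` is definitionally the bound `+ ψ A / 1` of `InPolymatroid`.
fromℤ : ℤ → ℚ
fromℤ z = z / 1

fromℕ : ℕ → ℚ
fromℕ k = fromℤ (+ k)

fromℤ≡mkℚ : ∀ z → fromℤ z ≡ mkℚ z 0 (Coprime.sym (Coprime.1-coprimeTo ℤ.∣ z ∣))
fromℤ≡mkℚ (+ n)    = normalize-coprime (Coprime.sym (Coprime.1-coprimeTo n))
fromℤ≡mkℚ -[1+ n ] = cong -_ (normalize-coprime (Coprime.sym (Coprime.1-coprimeTo (suc n))))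

fromℤ-+ : ∀ a b → fromℤ (a ℤ.+ b) ≡ fromℤ a + fromℤ b
fromℤ-+ a b rewrite fromℤ≡mkℚ a | fromℤ≡mkℚ b =
  sym (/-cong (cong₂ ℤ._+_ (ℤ.*-identityʳ a) (ℤ.*-identityʳ b)) refl)

fromℤ-neg : ∀ a → fromℤ (ℤ.- a) ≡ - fromℤ a
fromℤ-neg (+ zero)  = refl
fromℤ-neg (+ suc n) = refl
fromℤ-neg -[1+ n ]  = sym (neg-involutive (fromℤ (+ suc n)))

fromℤ-mono-≤ : ∀ {a b} → a ℤ.≤ b → fromℤ a ≤ fromℤ b
fromℤ-mono-≤ {a} {b} a≤b rewrite fromℤ≡mkℚ a | fromℤ≡mkℚ b =
  *≤* (subst₂ ℤ._≤_ (sym (ℤ.*-identityʳ a)) (sym (ℤ.*-identityʳ b)) a≤b)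

fromℤ-cancel-≤ : ∀ {a b} → fromℤ a ≤ fromℤ b → a ℤ.≤ b
fromℤ-cancel-≤ {a} {b} fa≤fb rewrite fromℤ≡mkℚ a | fromℤ≡mkℚ b =
  subst₂ ℤ._≤_ (ℤ.*-identityʳ a) (ℤ.*-identityʳ b) (drop-*≤* fa≤fb)

fromℕ-mono-≤ : ∀ {a b} → a ℕ.≤ b → fromℕ a ≤ fromℕ b
fromℕ-mono-≤ = fromℤ-mono-≤ ∘ +≤+

fromℕ-cancel-≤ : ∀ {a b} → fromℕ a ≤ fromℕ b → a ℕ.≤ b
fromℕ-cancel-≤ = drop‿+≤+ ∘ fromℤ-cancel-≤

IsInteger : ℚ → Set
IsInteger q = ∃[ z ] q ≡ fromℤ z

isInteger? : Decidable IsInteger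
isInteger? q@(mkℚ n d _) with d ℕ.≟ 0
... | yes refl = yes (n , sym (↥p/↧p≡p q))
... | no d≢0   = no λ (z , q≡z) → d≢0 (cong ℚ.denominator-1 (trans q≡z (fromℤ≡mkℚ z)))

isInteger-+ : ∀ {p q} → IsInteger p → IsInteger q → IsInteger (p + q)
isInteger-+ (a , p≡a) (b , q≡b) = a ℤ.+ b , trans (cong₂ _+_ p≡a q≡b) (sym (fromℤ-+ a b))

isInteger-+-cancelʳ : ∀ {p q} → IsInteger (p + q) → IsInteger q → IsInteger p
isInteger-+-cancelʳ {p} {q} (a , p+q≡a) (b , q≡b) = a ℤ.+ ℤ.- b , (begin
  p                       ≡⟨ solve 2 (λ p q → p := (p :+ q) :- q) refl p q ⟩
  (p + q) - q             ≡⟨ cong₂ _-_ p+q≡a q≡b ⟩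
  fromℤ a - fromℤ b       ≡⟨ cong (_+_ (fromℤ a)) (fromℤ-neg b) ⟨
  fromℤ a + fromℤ (ℤ.- b) ≡⟨ fromℤ-+ a (ℤ.- b) ⟨
  fromℤ (a ℤ.+ ℤ.- b)     ∎)
  where open ≡-Reasoning

isInteger-+-cancelˡ : ∀ {p q} → IsInteger p → IsInteger (p + q) → IsInteger q
isInteger-+-cancelˡ {p} {q} p-int p+q-int =
  isInteger-+-cancelʳ (subst IsInteger (+-comm p q) p+q-int) p-int

≤∧≢⇒< : ∀ {p q} → p ≤ q → p ≢ q → p < q
≤∧≢⇒< {p} {q} p≤q p≢q with <-cmp p q
... | tri< p<q _ _ = p<q
... | tri≈ _ p≡q _ = ⊥-elim (p≢q p≡q)
... | tri> _ _ q<p = ⊥-elim (<-irrefl refl (<-≤-trans q<p p≤q))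

p<q⇒0<q-p : ∀ {p q} → p < q → 0ℚ < q - p
p<q⇒0<q-p {p} {q} p<q = subst (_< q - p) (+-inverseʳ p) (+-monoˡ-< (- p) p<q)

<-⊓ : ∀ {r p q} → r < p → r < q → r < p ⊓ q
<-⊓ {r} {p} {q} r<p r<q with ⊓-sel p q
... | inj₁ p⊓q≡p = subst (r <_) (sym p⊓q≡p) r<p
... | inj₂ p⊓q≡q = subst (r <_) (sym p⊓q≡q) r<q

p≤∣p∣ : ∀ p → p ≤ ∣ p ∣
p≤∣p∣ (mkℚ (+ _) _ _)       = ≤-refl
p≤∣p∣ p@(mkℚ -[1+ _ ] _ _) = <⇒≤ (neg<pos p ∣ p ∣)

∣p∣≤q⇒-q≤p≤q : ∀ {p q} → ∣ p ∣ ≤ q → - q ≤ p × p ≤ q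
∣p∣≤q⇒-q≤p≤q {p} {q} ∣p∣≤q =
  subst (- q ≤_) (neg-involutive p) (neg-antimono-≤ -p≤q) , ≤-trans (p≤∣p∣ p) ∣p∣≤q
  where
  -p≤q : - p ≤ q
  -p≤q = ≤-trans (p≤∣p∣ (- p)) (subst (_≤ q) (sym (∣-p∣≡∣p∣ p)) ∣p∣≤q)

∣p*q∣≤r : ∀ {p q r} → ∣ p ∣ ≤ r → ∣ q ∣ ≤ 1ℚ → ∣ p * q ∣ ≤ r
∣p*q∣≤r {p} {q} {r} ∣p∣≤r ∣q∣≤1 = begin
  ∣ p * q ∣     ≡⟨ ∣p*q∣≡∣p∣*∣q∣ p q ⟩
  ∣ p ∣ * ∣ q ∣ ≤⟨ *-monoʳ-≤-nonNeg ∣ q ∣ {{∣-∣-nonNeg q}} ∣p∣≤r ⟩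
  r * ∣ q ∣     ≤⟨ *-monoˡ-≤-nonNeg r {{nonNegative r≥0}} ∣q∣≤1 ⟩
  r * 1ℚ        ≡⟨ *-identityʳ r ⟩
  r             ∎
  where
  open ≤-Reasoning
  r≥0 : 0ℚ ≤ r
  r≥0 = ≤-trans (0≤∣p∣ p) ∣p∣≤r

pos*p≡0⇒p≡0 : ∀ {c p} → 0ℚ < c → c * p ≡ 0ℚ → p ≡ 0ℚ
pos*p≡0⇒p≡0 {c} {p} 0<c cp≡0 = begin
  p              ≡⟨ *-identityˡ p ⟨
  1ℚ * p         ≡⟨ cong (_* p) (*-inverseˡ c) ⟨
  (1/ c * c) * p ≡⟨ *-assoc (1/ c) c p ⟩
  1/ c * (c * p) ≡⟨ cong (1/ c *_) cp≡0 ⟩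
  1/ c * 0ℚ      ≡⟨ *-zeroʳ (1/ c) ⟩
  0ℚ             ∎
  where
  open ≡-Reasoning
  instance
    c≢0 : NonZero c
    c≢0 = pos⇒nonZero c {{positive 0<c}}

∃-positive-lowerBound : ∀ {A : Set} (f : A → ℚ) (xs : List A) →
  ∃[ ε ] 0ℚ < ε × (∀ {a} → a ∈ₗ xs → 0ℚ < f a → ε ≤ f a)
∃-positive-lowerBound f [] = 1ℚ , positive⁻¹ _ , λ ()
∃-positive-lowerBound f (a ∷ xs) with ∃-positive-lowerBound f xs | 0ℚ <? f a
... | ε , 0<ε , ε≤ | yes 0<fa = ε ⊓ f a , <-⊓ 0<ε 0<fa , λ
  { (here refl) _  → p⊓q≤q ε (f a)
  ; (there b∈xs) 0<fb → p≤q⇒p⊓r≤q (f a) (ε≤ b∈xs 0<fb) }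
... | ε , 0<ε , ε≤ | no ¬0<fa = ε , 0<ε , λ
  { (here refl) 0<fa → ⊥-elim (¬0<fa 0<fa)
  ; (there b∈xs) 0<fb → ε≤ b∈xs 0<fb }

allSubsets : ∀ n → List (Subset n)
allSubsets zero    = [] ∷ []
allSubsets (suc n) = List.map (true ∷_) (allSubsets n) ++ List.map (false ∷_) (allSubsets n)

∈-allSubsets : ∀ {n} (A : Subset n) → A ∈ₗ allSubsets n
∈-allSubsets []          = here refl
∈-allSubsets (true ∷ A)  = ∈-++⁺ˡ (∈-map⁺ (true ∷_) (∈-allSubsets A))
∈-allSubsets {suc n} (false ∷ A) =
  ∈-++⁺ʳ (List.map (true ∷_) (allSubsets n)) (∈-map⁺ (false ∷_) (∈-allSubsets A))

sumOver-∩-∪ : ∀ {n} (A B : Subset n) (x : Vec ℚ n) →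
  sumOver (A ∩ B) x + sumOver (A ∪ B) x ≡ sumOver A x + sumOver B x
sumOver-∩-∪ []          []          []      = refl
sumOver-∩-∪ (true ∷ A)  (true ∷ B)  (q ∷ x) = begin
  (q + sumOver (A ∩ B) x) + (q + sumOver (A ∪ B) x)
    ≡⟨ solve 3 (λ q s t → (q :+ s) :+ (q :+ t) := (q :+ q) :+ (s :+ t)) refl q (sumOver (A ∩ B) x) (sumOver (A ∪ B) x) ⟩
  (q + q) + (sumOver (A ∩ B) x + sumOver (A ∪ B) x)
    ≡⟨ cong (_+_ (q + q)) (sumOver-∩-∪ A B x) ⟩
  (q + q) + (sumOver A x + sumOver B x)
    ≡⟨ solve 3 (λ q s t → (q :+ q) :+ (s :+ t) := (q :+ s) :+ (q :+ t)) refl q (sumOver A x) (sumOver B x) ⟩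
  (q + sumOver A x) + (q + sumOver B x) ∎
  where open ≡-Reasoning
sumOver-∩-∪ (true ∷ A)  (false ∷ B) (q ∷ x) = begin
  sumOver (A ∩ B) x + (q + sumOver (A ∪ B) x)
    ≡⟨ solve 3 (λ q s t → s :+ (q :+ t) := q :+ (s :+ t)) refl q (sumOver (A ∩ B) x) (sumOver (A ∪ B) x) ⟩
  q + (sumOver (A ∩ B) x + sumOver (A ∪ B) x)
    ≡⟨ cong (_+_ q) (sumOver-∩-∪ A B x) ⟩
  q + (sumOver A x + sumOver B x)
    ≡⟨ +-assoc q (sumOver A x) (sumOver B x) ⟨
  (q + sumOver A x) + sumOver B x ∎
  where open ≡-Reasoning
sumOver-∩-∪ (false ∷ A) (true ∷ B)  (q ∷ x) = begin
  sumOver (A ∩ B) x + (q + sumOver (A ∪ B) x)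
    ≡⟨ solve 3 (λ q s t → s :+ (q :+ t) := q :+ (s :+ t)) refl q (sumOver (A ∩ B) x) (sumOver (A ∪ B) x) ⟩
  q + (sumOver (A ∩ B) x + sumOver (A ∪ B) x)
    ≡⟨ cong (_+_ q) (sumOver-∩-∪ A B x) ⟩
  q + (sumOver A x + sumOver B x)
    ≡⟨ solve 3 (λ q s t → q :+ (s :+ t) := s :+ (q :+ t)) refl q (sumOver A x) (sumOver B x) ⟩
  sumOver A x + (q + sumOver B x) ∎
  where open ≡-Reasoning
sumOver-∩-∪ (false ∷ A) (false ∷ B) (q ∷ x) = sumOver-∩-∪ A B x

infixl 6 _⊕_
infixl 7 _·_

_⊕_ : ∀ {n} → Vec ℚ n → Vec ℚ n → Vec ℚ n
x ⊕ y = zipWith _+_ x y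

_·_ : ∀ {n} → ℚ → Vec ℚ n → Vec ℚ n
c · d = map (c *_) d

lookup-⊕-· : ∀ {n} (x : Vec ℚ n) c d k → lookup (x ⊕ c · d) k ≡ lookup x k + c * lookup d k
lookup-⊕-· x c d k =
  trans (lookup-zipWith _+_ k x (c · d)) (cong (_+_ (lookup x k)) (lookup-map k (c *_) d))

sumOver-⊕-· : ∀ {n} (A : Subset n) (x : Vec ℚ n) c d →
  sumOver A (x ⊕ c · d) ≡ sumOver A x + c * sumOver A d
sumOver-⊕-· []          []      c []      = solve 1 (λ c → con 0ℚ := con 0ℚ :+ c :* con 0ℚ) refl c
sumOver-⊕-· (true ∷ A)  (p ∷ x) c (q ∷ d) = begin
  (p + c * q) + sumOver A (x ⊕ c · d)
    ≡⟨ cong (_+_ (p + c * q)) (sumOver-⊕-· A x c d) ⟩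
  (p + c * q) + (sumOver A x + c * sumOver A d)
    ≡⟨ solve 5 (λ p c q s t → (p :+ c :* q) :+ (s :+ c :* t) := (p :+ s) :+ c :* (q :+ t)) refl p c q (sumOver A x) (sumOver A d) ⟩
  (p + sumOver A x) + c * (q + sumOver A d) ∎
  where open ≡-Reasoning
sumOver-⊕-· (false ∷ A) (p ∷ x) c (q ∷ d) = sumOver-⊕-· A x c d

unit : ∀ {n} → Fin n → Vec ℚ n
unit {suc n} zero = 1ℚ ∷ replicate n 0ℚ
unit (suc i)      = 0ℚ ∷ unit i

sumOver-replicate-0 : ∀ {n} (A : Subset n) → sumOver A (replicate n 0ℚ) ≡ 0ℚ
sumOver-replicate-0 []          = refl
sumOver-replicate-0 (true ∷ A)  = trans (+-identityˡ _) (sumOver-replicate-0 A)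
sumOver-replicate-0 (false ∷ A) = sumOver-replicate-0 A

sumOver-unit-∈ : ∀ {n} (A : Subset n) {i} → i ∈ A → sumOver A (unit i) ≡ 1ℚ
sumOver-unit-∈ (true ∷ A)  Vec.here        = trans (cong (_+_ 1ℚ) (sumOver-replicate-0 A)) (+-identityʳ 1ℚ)
sumOver-unit-∈ (true ∷ A)  (Vec.there i∈A) = trans (+-identityˡ _) (sumOver-unit-∈ A i∈A)
sumOver-unit-∈ (false ∷ A) (Vec.there i∈A) = sumOver-unit-∈ A i∈A

sumOver-unit-∉ : ∀ {n} (A : Subset n) {i} → i ∉ A → sumOver A (unit i) ≡ 0ℚ
sumOver-unit-∉ (true ∷ A)  {zero}  i∉A = ⊥-elim (i∉A Vec.here)
sumOver-unit-∉ (false ∷ A) {zero}  i∉A = sumOver-replicate-0 A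
sumOver-unit-∉ (true ∷ A)  {suc i} i∉A = trans (+-identityˡ _) (sumOver-unit-∉ A (i∉A ∘ Vec.there))
sumOver-unit-∉ (false ∷ A) {suc i} i∉A = sumOver-unit-∉ A (i∉A ∘ Vec.there)

lookup-unit-≡ : ∀ {n} (i : Fin n) → lookup (unit i) i ≡ 1ℚ
lookup-unit-≡ zero    = refl
lookup-unit-≡ (suc i) = lookup-unit-≡ i

lookup-unit-≢ : ∀ {n} {i k : Fin n} → k ≢ i → lookup (unit i) k ≡ 0ℚ
lookup-unit-≢ {i = zero}  {zero}  k≢i = ⊥-elim (k≢i refl)
lookup-unit-≢ {i = zero}  {suc k} k≢i = lookup-replicate k 0ℚ
lookup-unit-≢ {i = suc i} {zero}  k≢i = refl
lookup-unit-≢ {i = suc i} {suc k} k≢i = lookup-unit-≢ (k≢i ∘ cong suc)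

Bit : ℚ → Set
Bit q = q ≡ 0ℚ ⊎ q ≡ 1ℚ

sumOver-unit-bit : ∀ {n} (A : Subset n) i → Bit (sumOver A (unit i))
sumOver-unit-bit A i with i ∈? A
... | yes i∈A = inj₂ (sumOver-unit-∈ A i∈A)
... | no  i∉A = inj₁ (sumOver-unit-∉ A i∉A)

lookup-unit-bit : ∀ {n} (i k : Fin n) → Bit (lookup (unit i) k)
lookup-unit-bit i k with k ≟ᶠ i
... | yes refl = inj₂ (lookup-unit-≡ i)
... | no  k≢i  = inj₁ (lookup-unit-≢ k≢i)

∣bit∣≤1 : ∀ {u} → Bit u → ∣ u ∣ ≤ 1ℚ
∣bit∣≤1 (inj₁ refl) = *≤* (+≤+ z≤n)
∣bit∣≤1 (inj₂ refl) = ≤-refl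

∣bit-bit∣≤1 : ∀ {u v} → Bit u → Bit v → ∣ u + - 1ℚ * v ∣ ≤ 1ℚ
∣bit-bit∣≤1 (inj₁ refl) (inj₁ refl) = *≤* (+≤+ z≤n)
∣bit-bit∣≤1 (inj₁ refl) (inj₂ refl) = ≤-refl
∣bit-bit∣≤1 (inj₂ refl) (inj₁ refl) = ≤-refl
∣bit-bit∣≤1 (inj₂ refl) (inj₂ refl) = *≤* (+≤+ z≤n)

isInteger-sumOver : ∀ {n} (A : Subset n) (x : Vec ℚ n) →
  (∀ {k} → k ∈ A → IsInteger (lookup x k)) → IsInteger (sumOver A x)
isInteger-sumOver []          []      ints = + 0 , refl
isInteger-sumOver (true ∷ A)  (q ∷ x) ints = isInteger-+ (ints Vec.here) (isInteger-sumOver A x (ints ∘ Vec.there))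
isInteger-sumOver (false ∷ A) (q ∷ x) ints = isInteger-sumOver A x (ints ∘ Vec.there)

isInteger-sumOver-except : ∀ {n} (A : Subset n) (x : Vec ℚ n) {i} → i ∈ A →
  (∀ {k} → k ∈ A → k ≢ i → IsInteger (lookup x k)) →
  IsInteger (sumOver A x) → IsInteger (lookup x i)
isInteger-sumOver-except (true ∷ A) (q ∷ x) Vec.here ints sum-int =
  isInteger-+-cancelʳ sum-int (isInteger-sumOver A x (λ k∈A → ints (Vec.there k∈A) λ ()))
isInteger-sumOver-except (true ∷ A) (q ∷ x) (Vec.there i∈A) ints sum-int =
  isInteger-sumOver-except A x i∈A (λ k∈A k≢i → ints (Vec.there k∈A) (k≢i ∘ suc-injective))
    (isInteger-+-cancelˡ (ints Vec.here λ ()) sum-int)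
isInteger-sumOver-except (false ∷ A) (q ∷ x) (Vec.there i∈A) ints sum-int =
  isInteger-sumOver-except A x i∈A (λ k∈A k≢i → ints (Vec.there k∈A) (k≢i ∘ suc-injective)) sum-int

-- Tight sets and vertices

Tight : ∀ {n} → (Subset n → ℕ) → Vec ℚ n → Subset n → Set
Tight ψ x A = sumOver A x ≡ fromℕ (ψ A)

tight-∩ : ∀ {n} {ψ : Subset n → ℕ} {x} {A B} → IsPolymatroidRank ψ → InPolymatroid ψ x →
  Tight ψ x A → Tight ψ x B → Tight ψ x (A ∩ B)
tight-∩ {ψ = ψ} {x} {A} {B} ψ-rank x∈P A-tight B-tight =
  ≤-antisym (proj₂ x∈P (A ∩ B)) (≮⇒≥ ¬sum<rank)
  where
  open IsPolymatroidRank ψ-rank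
  rank-∩+∪≤sum-∩+∪ : fromℕ (ψ (A ∩ B)) + fromℕ (ψ (A ∪ B)) ≤ sumOver (A ∩ B) x + sumOver (A ∪ B) x
  rank-∩+∪≤sum-∩+∪ = begin
    fromℕ (ψ (A ∩ B)) + fromℕ (ψ (A ∪ B)) ≡⟨ fromℤ-+ (+ ψ (A ∩ B)) (+ ψ (A ∪ B)) ⟨
    fromℕ (ψ (A ∩ B) ℕ.+ ψ (A ∪ B))       ≤⟨ fromℕ-mono-≤ (submodular A B) ⟩
    fromℕ (ψ A ℕ.+ ψ B)                   ≡⟨ fromℤ-+ (+ ψ A) (+ ψ B) ⟩
    fromℕ (ψ A) + fromℕ (ψ B)             ≡⟨ cong₂ _+_ A-tight B-tight ⟨
    sumOver A x + sumOver B x             ≡⟨ sumOver-∩-∪ A B x ⟨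
    sumOver (A ∩ B) x + sumOver (A ∪ B) x ∎
    where open ≤-Reasoning
  ¬sum<rank : ¬ (sumOver (A ∩ B) x < fromℕ (ψ (A ∩ B)))
  ¬sum<rank sum<rank = <-irrefl refl
    (<-≤-trans (+-mono-<-≤ sum<rank (proj₂ x∈P (A ∪ B))) rank-∩+∪≤sum-∩+∪)

-- A direction along which x can move both ways inside P(ψ): it is zero on tight sets and on the
-- zero coordinates of x. The bounds by 1 only normalise d, so that one ε serves all constraints.
record AdmissibleDirection {n} (ψ : Subset n → ℕ) (x d : Vec ℚ n) : Set where
  field
    sum-tight     : ∀ A → Tight ψ x A → sumOver A d ≡ 0ℚ
    sum-bounded   : ∀ A → ∣ sumOver A d ∣ ≤ 1ℚ
    support       : ∀ k → lookup x k ≡ 0ℚ → lookup d k ≡ 0ℚ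
    coord-bounded : ∀ k → ∣ lookup d k ∣ ≤ 1ℚ

module _ {n} {ψ : Subset n → ℕ} {x : Vec ℚ n} (x∈P : InPolymatroid ψ x)
         {d : Vec ℚ n} (d-admissible : AdmissibleDirection ψ x d) where

  open AdmissibleDirection d-admissible

  private
    slack : Subset n → ℚ
    slack A = fromℕ (ψ A) - sumOver A x

    slack-bound : ∃[ ε ] 0ℚ < ε × (∀ {A} → A ∈ₗ allSubsets n → 0ℚ < slack A → ε ≤ slack A)
    slack-bound = ∃-positive-lowerBound slack (allSubsets n)

    coord-bound : ∃[ ε ] 0ℚ < ε × (∀ {k} → k ∈ₗ allFin n → 0ℚ < lookup x k → ε ≤ lookup x k)
    coord-bound = ∃-positive-lowerBound (lookup x) (allFin n)

    ε : ℚ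
    ε = proj₁ slack-bound ⊓ proj₁ coord-bound

    0<ε : 0ℚ < ε
    0<ε = <-⊓ (proj₁ (proj₂ slack-bound)) (proj₁ (proj₂ coord-bound))

    ε≤slack : ∀ {A} → ¬ Tight ψ x A → ε ≤ slack A
    ε≤slack {A} ¬tight = p≤q⇒p⊓r≤q (proj₁ coord-bound)
      (proj₂ (proj₂ slack-bound) (∈-allSubsets A) (p<q⇒0<q-p (≤∧≢⇒< (proj₂ x∈P A) ¬tight)))

    ε≤coord : ∀ {k} → lookup x k ≢ 0ℚ → ε ≤ lookup x k
    ε≤coord {k} xₖ≢0 = p≤q⇒r⊓p≤q (proj₁ slack-bound)
      (proj₂ (proj₂ coord-bound) (∈-allFin k) (≤∧≢⇒< (proj₁ x∈P k) (xₖ≢0 ∘ sym)))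

    perturbation-feasible : ∀ {c} → ∣ c ∣ ≤ ε → InPolymatroid ψ (x ⊕ c · d)
    perturbation-feasible {c} ∣c∣≤ε = coords-nonNeg , sums-bounded
      where
      c*-bounded : ∀ {s} → ∣ s ∣ ≤ 1ℚ → - ε ≤ c * s × c * s ≤ ε
      c*-bounded ∣s∣≤1 = ∣p∣≤q⇒-q≤p≤q (∣p*q∣≤r ∣c∣≤ε ∣s∣≤1)
      coords-nonNeg : ∀ k → 0ℚ ≤ lookup (x ⊕ c · d) k
      coords-nonNeg k rewrite lookup-⊕-· x c d k with lookup x k ≟ 0ℚ
      ... | yes xₖ≡0 rewrite support k xₖ≡0 | *-zeroʳ c | +-identityʳ (lookup x k) = proj₁ x∈P k
      ... | no  xₖ≢0 = begin
        0ℚ                          ≡⟨ +-inverseʳ ε ⟨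
        ε - ε                       ≤⟨ +-mono-≤ (ε≤coord xₖ≢0) (proj₁ (c*-bounded (coord-bounded k))) ⟩
        lookup x k + c * lookup d k ∎
        where open ≤-Reasoning
      sums-bounded : ∀ A → sumOver A (x ⊕ c · d) ≤ fromℕ (ψ A)
      sums-bounded A rewrite sumOver-⊕-· A x c d with sumOver A x ≟ fromℕ (ψ A)
      ... | yes tight rewrite sum-tight A tight | *-zeroʳ c | +-identityʳ (sumOver A x) = ≤-reflexive tight
      ... | no ¬tight = begin
        sumOver A x + c * sumOver A d ≤⟨ +-monoʳ-≤ (sumOver A x) (proj₂ (c*-bounded (sum-bounded A))) ⟩
        sumOver A x + ε               ≤⟨ +-monoʳ-≤ (sumOver A x) (ε≤slack ¬tight) ⟩
        sumOver A x + slack A         ≡⟨ solve 2 (λ s r → s :+ (r :- s) := r) refl (sumOver A x) (fromℕ (ψ A)) ⟩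
        fromℕ (ψ A)                   ∎
        where open ≤-Reasoning

  ∃-feasible-perturbation : ∃[ ε ] 0ℚ < ε × (∀ {c} → ∣ c ∣ ≤ ε → InPolymatroid ψ (x ⊕ c · d))
  ∃-feasible-perturbation = ε , 0<ε , perturbation-feasible

vertex-rigid : ∀ {n} {ψ : Subset n → ℕ} {x d : Vec ℚ n} → IsVertex ψ x → AdmissibleDirection ψ x d →
  ∀ k → lookup d k ≡ 0ℚ
vertex-rigid {n} {x = x} {d} (x∈P , x-extreme) d-admissible k
  with ε , 0<ε , feasible ← ∃-feasible-perturbation x∈P d-admissible =
  pos*p≡0⇒p≡0 (+-mono-< 0<ε 0<ε) (begin
    (ε + ε) * lookup d k
      ≡⟨ solve 3 (λ a e t → (e :+ e) :* t := (a :+ e :* t) :- (a :+ (:- e) :* t)) refl (lookup x k) ε (lookup d k) ⟩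
    (lookup x k + ε * lookup d k) - (lookup x k + (- ε) * lookup d k)
      ≡⟨ cong₂ _-_ (lookup-⊕-· x ε d k) (lookup-⊕-· x (- ε) d k) ⟨
    lookup y k - lookup z k
      ≡⟨ cong (λ v → lookup y k - lookup v k) y≡z ⟨
    lookup y k - lookup y k
      ≡⟨ +-inverseʳ (lookup y k) ⟩
    0ℚ ∎)
  where
  open ≡-Reasoning
  y z : Vec ℚ n
  y = x ⊕ ε · d
  z = x ⊕ (- ε) · d
  ∣ε∣≤ε : ∣ ε ∣ ≤ ε
  ∣ε∣≤ε = ≤-reflexive (0≤p⇒∣p∣≡p (<⇒≤ 0<ε))
  x-midpoint : ∀ i → lookup x i ≡ ½ * (lookup y i + lookup z i)
  x-midpoint i = begin
    lookup x i
      ≡⟨ solve 3 (λ a e t → a := con ½ :* ((a :+ e :* t) :+ (a :+ (:- e) :* t))) refl (lookup x i) ε (lookup d i) ⟩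
    ½ * ((lookup x i + ε * lookup d i) + (lookup x i + (- ε) * lookup d i))
      ≡⟨ cong₂ (λ u v → ½ * (u + v)) (lookup-⊕-· x ε d i) (lookup-⊕-· x (- ε) d i) ⟨
    ½ * (lookup y i + lookup z i) ∎
  y≡z : y ≡ z
  y≡z = x-extreme y z (feasible ∣ε∣≤ε) (feasible (≤-trans (≤-reflexive (∣-p∣≡∣p∣ ε)) ∣ε∣≤ε)) x-midpoint

-- Integrality of vertices

x∈q∧x∉p⇒∣p∩q∣<∣q∣ : ∀ {n} {p q : Subset n} {x} → x ∈ q → x ∉ p → ∣ p ∩ q ∣ˢ ℕ.< ∣ q ∣ˢ
x∈q∧x∉p⇒∣p∩q∣<∣q∣ {p = p} {q} x∈q x∉p =
  p⊂q⇒∣p∣<∣q∣ (p∩q⊆q p q , _ , x∈q , x∉p ∘ proj₁ ∘ x∈p∩q⁻ p q)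

exchange : ∀ {n} → Fin n → Fin n → Vec ℚ n
exchange i j = unit i ⊕ (- 1ℚ) · unit j

module _ {n} {ψ : Subset n → ℕ} (ψ-rank : IsPolymatroidRank ψ) {x : Vec ℚ n} (x-vertex : IsVertex ψ x) where

  private
    x∈P : InPolymatroid ψ x
    x∈P = proj₁ x-vertex

    fractional≢0 : ∀ {k} → ¬ IsInteger (lookup x k) → lookup x k ≢ 0ℚ
    fractional≢0 frac xₖ≡0 = frac (+ 0 , xₖ≡0)

  integral-on-tight : ∀ T → Acc ℕ._<_ ∣ T ∣ˢ → Tight ψ x T → ∀ {i} → i ∈ T → IsInteger (lookup x i)
  integral-on-tight T (acc smaller) T-tight {i} i∈T with isInteger? (lookup x i)
  ... | yes xᵢ-int = xᵢ-int
  ... | no  xᵢ-frac with any? (λ j → j ∈? T ×-dec ¬? (j ≟ᶠ i) ×-dec ¬? (isInteger? (lookup x j)))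
  ...   | no  ¬other-frac = isInteger-sumOver-except T x i∈T others-int (+ ψ T , T-tight)
    where
    others-int : ∀ {k} → k ∈ T → k ≢ i → IsInteger (lookup x k)
    others-int k∈T k≢i = decidable-stable (isInteger? _) λ xₖ-frac → ¬other-frac (_ , k∈T , k≢i , xₖ-frac)
  ...   | yes (j , j∈T , j≢i , xⱼ-frac) = ⊥-elim (1≢0 (begin
    1ℚ
      ≡⟨ cong₂ (λ u v → u + - 1ℚ * v) (lookup-unit-≡ i) (lookup-unit-≢ (j≢i ∘ sym)) ⟨
    lookup (unit i) i + - 1ℚ * lookup (unit j) i
      ≡⟨ lookup-⊕-· (unit i) (- 1ℚ) (unit j) i ⟨
    lookup (exchange i j) i
      ≡⟨ vertex-rigid x-vertex admissible i ⟩
    0ℚ ∎))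
    where
    open ≡-Reasoning
    separation⇒⊥ : ∀ {A} → Tight ψ x A → ∀ {k l} → k ∈ T → ¬ IsInteger (lookup x k) → k ∈ A → l ∈ T → l ∉ A → ⊥
    separation⇒⊥ {A} A-tight k∈T xₖ-frac k∈A l∈T l∉A = xₖ-frac (integral-on-tight (A ∩ T)
      (smaller (x∈q∧x∉p⇒∣p∩q∣<∣q∣ l∈T l∉A)) (tight-∩ ψ-rank x∈P A-tight T-tight) (x∈p∩q⁺ (k∈A , k∈T)))
    sum-tight : ∀ A → Tight ψ x A → sumOver A (exchange i j) ≡ 0ℚ
    sum-tight A A-tight rewrite sumOver-⊕-· A (unit i) (- 1ℚ) (unit j) with i ∈? A | j ∈? A
    ... | yes i∈A | yes j∈A rewrite sumOver-unit-∈ A i∈A | sumOver-unit-∈ A j∈A = refl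
    ... | no  i∉A | no  j∉A rewrite sumOver-unit-∉ A i∉A | sumOver-unit-∉ A j∉A = refl
    ... | yes i∈A | no  j∉A = ⊥-elim (separation⇒⊥ A-tight i∈T xᵢ-frac i∈A j∈T j∉A)
    ... | no  i∉A | yes j∈A = ⊥-elim (separation⇒⊥ A-tight j∈T xⱼ-frac j∈A i∈T i∉A)
    support : ∀ k → lookup x k ≡ 0ℚ → lookup (exchange i j) k ≡ 0ℚ
    support k xₖ≡0 with k ≟ᶠ i | k ≟ᶠ j
    ... | yes refl | _        = ⊥-elim (fractional≢0 xᵢ-frac xₖ≡0)
    ... | no  _    | yes refl = ⊥-elim (fractional≢0 xⱼ-frac xₖ≡0)
    ... | no  k≢i  | no  k≢j  rewrite lookup-⊕-· (unit i) (- 1ℚ) (unit j) k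
                                    | lookup-unit-≢ k≢i | lookup-unit-≢ k≢j = refl
    admissible : AdmissibleDirection ψ x (exchange i j)
    admissible = record
      { sum-tight     = sum-tight
      ; sum-bounded   = λ A → subst (λ s → ∣ s ∣ ≤ 1ℚ) (sym (sumOver-⊕-· A (unit i) (- 1ℚ) (unit j)))
                                (∣bit-bit∣≤1 (sumOver-unit-bit A i) (sumOver-unit-bit A j))
      ; support       = support
      ; coord-bounded = λ k → subst (λ s → ∣ s ∣ ≤ 1ℚ) (sym (lookup-⊕-· (unit i) (- 1ℚ) (unit j) k))
                                (∣bit-bit∣≤1 (lookup-unit-bit i k) (lookup-unit-bit j k))
      }

  vertex-integral : ∀ i → IsInteger (lookup x i)
  vertex-integral i with isInteger? (lookup x i)
  ... | yes xᵢ-int = xᵢ-int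
  ... | no  xᵢ-frac = ⊥-elim (1≢0 (trans (sym (lookup-unit-≡ i)) (vertex-rigid x-vertex admissible i)))
    where
    sum-tight : ∀ A → Tight ψ x A → sumOver A (unit i) ≡ 0ℚ
    sum-tight A A-tight with i ∈? A
    ... | yes i∈A = ⊥-elim (xᵢ-frac (integral-on-tight A (<-wellFounded _) A-tight i∈A))
    ... | no  i∉A = sumOver-unit-∉ A i∉A
    support : ∀ k → lookup x k ≡ 0ℚ → lookup (unit i) k ≡ 0ℚ
    support k xₖ≡0 with k ≟ᶠ i
    ... | yes refl = ⊥-elim (fractional≢0 xᵢ-frac xₖ≡0)
    ... | no  k≢i  = lookup-unit-≢ k≢i
    admissible : AdmissibleDirection ψ x (unit i)
    admissible = record
      { sum-tight     = sum-tight
      ; sum-bounded   = λ A → ∣bit∣≤1 (sumOver-unit-bit A i)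
      ; support       = support
      ; coord-bounded = λ k → ∣bit∣≤1 (lookup-unit-bit i k)
      }

-- Counting integral points

incrementHead : ∀ {n} → Vec ℕ (suc n) → Vec ℕ (suc n)
incrementHead (a ∷ v) = suc a ∷ v

vecsOfSum≤ : (n r : ℕ) → List (Vec ℕ n)
vecsOfSum≤ zero    r       = [] ∷ []
vecsOfSum≤ (suc n) zero    = List.map (0 Vec.∷_) (vecsOfSum≤ n zero)
vecsOfSum≤ (suc n) (suc r) =
  List.map (0 Vec.∷_) (vecsOfSum≤ n (suc r)) ++ List.map incrementHead (vecsOfSum≤ (suc n) r)

∈-vecsOfSum≤ : ∀ {n r} (v : Vec ℕ n) → Vec.sum v ℕ.≤ r → v ∈ₗ vecsOfSum≤ n r
∈-vecsOfSum≤ []                      _          = here refl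
∈-vecsOfSum≤ {r = zero}  (zero ∷ v)  Σv≤0       = ∈-map⁺ (0 Vec.∷_) (∈-vecsOfSum≤ v Σv≤0)
∈-vecsOfSum≤ {r = suc r} (zero ∷ v)  Σv≤r       = ∈-++⁺ˡ (∈-map⁺ (0 Vec.∷_) (∈-vecsOfSum≤ v Σv≤r))
∈-vecsOfSum≤ {suc n} {suc r} (suc a ∷ v) (s≤s Σv≤r) =
  ∈-++⁺ʳ (List.map (0 Vec.∷_) (vecsOfSum≤ n (suc r))) (∈-map⁺ incrementHead (∈-vecsOfSum≤ (a ∷ v) Σv≤r))

length-vecsOfSum≤ : ∀ n r → length (vecsOfSum≤ n r) ℕ.≤ suc n ^ r
length-vecsOfSum≤ zero    r       = ℕ.≤-reflexive (sym (ℕ.^-zeroˡ r))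
length-vecsOfSum≤ (suc n) zero    =
  ℕ.≤-trans (ℕ.≤-reflexive (length-map (0 Vec.∷_) (vecsOfSum≤ n zero))) (length-vecsOfSum≤ n zero)
length-vecsOfSum≤ (suc n) (suc r) = begin
  length (List.map (0 Vec.∷_) (vecsOfSum≤ n (suc r)) ++ List.map incrementHead (vecsOfSum≤ (suc n) r))
    ≡⟨ length-++ (List.map (0 Vec.∷_) (vecsOfSum≤ n (suc r))) ⟩
  length (List.map (0 Vec.∷_) (vecsOfSum≤ n (suc r))) ℕ.+ length (List.map incrementHead (vecsOfSum≤ (suc n) r))
    ≡⟨ cong₂ ℕ._+_ (length-map (0 Vec.∷_) (vecsOfSum≤ n (suc r))) (length-map incrementHead (vecsOfSum≤ (suc n) r)) ⟩
  length (vecsOfSum≤ n (suc r)) ℕ.+ length (vecsOfSum≤ (suc n) r)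
    ≤⟨ ℕ.+-mono-≤ (length-vecsOfSum≤ n (suc r)) (length-vecsOfSum≤ (suc n) r) ⟩
  suc n ℕ.* suc n ^ r ℕ.+ suc (suc n) ^ r
    ≤⟨ ℕ.+-monoˡ-≤ (suc (suc n) ^ r) (ℕ.*-monoʳ-≤ (suc n) (ℕ.^-monoˡ-≤ r (ℕ.n≤1+n (suc n)))) ⟩
  suc n ℕ.* suc (suc n) ^ r ℕ.+ suc (suc n) ^ r
    ≡⟨ ℕ.+-comm (suc n ℕ.* suc (suc n) ^ r) _ ⟩
  suc (suc n) ^ suc r ∎
  where open ℕ.≤-Reasoning

∃-removal : ∀ {A : Set} {v : A} {ys} → v ∈ₗ ys →
  ∃[ ys′ ] length ys ≡ suc (length ys′) × (∀ {w} → w ∈ₗ ys → w ≢ v → w ∈ₗ ys′)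
∃-removal {ys = _ ∷ ys} (here refl) = ys , refl , λ
  { (here refl) w≢v → ⊥-elim (w≢v refl)
  ; (there w∈ys) _  → w∈ys }
∃-removal {ys = u ∷ ys} (there v∈ys) with ∃-removal v∈ys
... | ys′ , |ys|≡1+|ys′| , keep = u ∷ ys′ , cong suc |ys|≡1+|ys′| , λ
  { (here refl) _   → here refl
  ; (there w∈ys) w≢v → there (keep w∈ys w≢v) }

Unique⇒length≤ : ∀ {A : Set} {xs ys : List A} → Unique xs → (∀ {w} → w ∈ₗ xs → w ∈ₗ ys) →
  length xs ℕ.≤ length ys
Unique⇒length≤ {xs = []}     _               _   = z≤n
Unique⇒length≤ {xs = v ∷ xs} (v∉xs ∷ unique) xs⊆ys with ∃-removal (xs⊆ys (here refl))
... | ys′ , |ys|≡1+|ys′| , keep = subst (suc (length xs) ℕ.≤_) (sym |ys|≡1+|ys′|)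
  (s≤s (Unique⇒length≤ unique (λ w∈xs → keep (xs⊆ys (there w∈xs)) (λ w≡v → All.lookup v∉xs w∈xs (sym w≡v)))))

∃-fromℕ-coordinates : ∀ {n} (w : Vec ℚ n) → (∀ k → IsInteger (lookup w k)) → (∀ k → 0ℚ ≤ lookup w k) →
  ∃[ u ] w ≡ map fromℕ u
∃-fromℕ-coordinates []      _    _      = [] , refl
∃-fromℕ-coordinates (q ∷ w) ints nonNeg with ints zero | ∃-fromℕ-coordinates w (ints ∘ suc) (nonNeg ∘ suc)
... | z , q≡z | u , w≡u with fromℤ-cancel-≤ {+ 0} {z} (subst (0ℚ ≤_) q≡z (nonNeg zero))
... | +≤+ {n = m} _ = m ∷ u , cong₂ _∷_ q≡z w≡u

sumOver-⊤-fromℕ : ∀ {n} (u : Vec ℕ n) → sumOver ⊤ (map fromℕ u) ≡ fromℕ (Vec.sum u)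
sumOver-⊤-fromℕ []      = refl
sumOver-⊤-fromℕ (a ∷ u) = trans (cong (_+_ (fromℕ a)) (sumOver-⊤-fromℕ u)) (sym (fromℤ-+ (+ a) (+ Vec.sum u)))

vertex∈vecsOfSum≤ : ∀ {n} r {ψ : Subset n → ℕ} → IsPolymatroidRank ψ → (∀ A → ψ A ℕ.≤ r) →
  ∀ {w} → IsVertex ψ w → w ∈ₗ List.map (map fromℕ) (vecsOfSum≤ n r)
vertex∈vecsOfSum≤ r {ψ} ψ-rank ψ≤r {w} w-vertex
  with ∃-fromℕ-coordinates w (vertex-integral ψ-rank w-vertex) (proj₁ (proj₁ w-vertex))
... | u , refl = ∈-map⁺ (map fromℕ) (∈-vecsOfSum≤ u (fromℕ-cancel-≤ (begin
  fromℕ (Vec.sum u)      ≡⟨ sumOver-⊤-fromℕ u ⟨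
  sumOver ⊤ (map fromℕ u) ≤⟨ proj₂ (proj₁ w-vertex) ⊤ ⟩
  fromℕ (ψ ⊤)            ≤⟨ fromℕ-mono-≤ (ψ≤r ⊤) ⟩
  fromℕ r                ∎)))
  where open ≤-Reasoning

lemma2p13 : (r : ℕ) → ∃[ C ] ((n : ℕ) (ψ : Subset n → ℕ) → IsPolymatroidRank ψ →
    (∀ A → ψ A ℕ.≤ r) → (vs : List (Vec ℚ n)) → Unique vs → All (IsVertex ψ) vs →
    length vs ℕ.≤ C ℕ.* (suc n) ^ r)
lemma2p13 r = 1 , λ n ψ ψ-rank ψ≤r vs unique vertices → begin
  length vs
    ≤⟨ Unique⇒length≤ unique (vertex∈vecsOfSum≤ r ψ-rank ψ≤r ∘ All.lookup vertices) ⟩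
  length (List.map (map fromℕ) (vecsOfSum≤ n r))
    ≡⟨ length-map (map fromℕ) (vecsOfSum≤ n r) ⟩
  length (vecsOfSum≤ n r)
    ≤⟨ length-vecsOfSum≤ n r ⟩
  suc n ^ r
    ≡⟨ ℕ.*-identityˡ (suc n ^ r) ⟨
  1 ℕ.* suc n ^ r ∎
  where open ℕ.≤-Reasoning
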